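{- For any prime $p\ge2$ and any positive integer $n_1$, there are an increasing sequence $\{n_j\}_{j\ge2}$ of positive integers and a power series $f(z)\in\mathbb{Z}_p[[z]]$ such that for all $j\ge1$, $$f(p^{n_j})=n_j\quad\text{and}\quad n_j+p^{n_j}\le n_{j+1}\le n_j+p^{n_1+\cdots+n_j}.$$ Moreover, $n_1+\cdots+n_{j-1}\le n_j$ for all $j\ge 2$, and hence $n_{j+1}\le n_j+p^{2n_j}$ for all $j\ge1$. -}

module Defs where

open import Data.Nat as ℕ using (ℕ; zero; suc)
open import Data.Integer as ℤ using (ℤ; +_)
open import Data.Integer.Divisibility using (_∣_)

-- p-adic integers ℤ_p, presented as the inverse limit of ℤ/p^k:
-- a sequence of integer representatives x_k of residues mod p^k,
-- compatible in the sense x_{k+1} ≡ x_k (mod p^k).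
record ℤ[_] (p : ℕ) : Set where
  field
    res    : ℕ → ℤ
    compat : ∀ k → (+ (p ℕ.^ k)) ∣ (res (suc k) ℤ.- res k)
open ℤ[_] public

PowerSeries : ℕ → Set
PowerSeries p = ℕ → ℤ[ p ]

sumℤ : (ℕ → ℤ) → ℕ → ℤ
sumℤ g zero    = + 0
sumℤ g (suc k) = sumℤ g k ℤ.+ g k

sumℕ : (ℕ → ℕ) → ℕ → ℕ
sumℕ g zero    = 0
sumℕ g (suc k) = sumℕ g k ℕ.+ g k

-- "f(p^m) = N" in ℤ_p, for m ≥ 1.  Since the i-th term a_i p^{m i} is
-- divisible by p^k once i ≥ k, the p-adic limit f(p^m) is determined
-- mod p^k by the partial sum Σ_{i<k} a_i p^{m i}, with a_i read mod p^k.
EvalAtPowEq : (p : ℕ) → PowerSeries p → (m N : ℕ) → Set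
EvalAtPowEq p f m N =
  ∀ k → (+ (p ℕ.^ k)) ∣
        (sumℤ (λ i → res (f i) k ℤ.* + (p ℕ.^ (m ℕ.* i))) k ℤ.- + N)

module Submission where

-- Nodes are indexed from 0 here.  At stage J the nodes n_0, …, n_J are
-- interpolated by G_J / D_J, where G_J ∈ ℤ[z] and D_J ∈ ℤ is a p-adic unit (a
-- product of numbers p^e - 1 with e ≥ 1).  With S = n_0 + ⋯ + n_J the next node
-- is n_{J+1} = n_J + p^{n_J} + V, where 0 ≤ V < p^S makes n_{J+1} ≡ G_J(0)/D_J
-- (mod p^S).  As G_J(0)/D_J ≡ G_J(p^{n_J})/D_J = n_J (mod p^{n_J}), p^{n_J}
-- divides V; this gives all the growth bounds.  Then
--   G_{J+1} = R·G_J + q·∏_{i ≤ J} (z - p^{n_i}),   D_{J+1} = R·D_J,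
-- where ∏_i (p^{n_{J+1}} - p^{n_i}) = p^S·R and q = (n_{J+1}·D_J - G_J(p^{n_{J+1}}))/p^S
-- is an integer by the choice of V.  Since every factor z - p^{n_i} is ≡ z
-- (mod p), the correction is p-adically small: modulo p^k the i-th coefficient
-- of G_J/D_J is constant from stage k + i on, and its value at p^m (m ≥ 1) from
-- stage k on.  The stabilised coefficients define f.

open import Defs
open import Data.Nat using (ℕ; _≤_; _<_)

module IntegerCongruence where
  open import Data.Nat as ℕ using (ℕ; zero; suc; _≤_; _<_; z≤n; s≤s; NonZero)
  import Data.Nat.Properties as ℕP
  import Data.Nat.Divisibility as ℕD
  open import Data.Integer using (ℤ; +_; _+_; _*_; _-_; -_; 0ℤ; 1ℤ; _%ℕ_; _/ℕ_)
  import Data.Integer.Properties as ℤP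
  open import Data.Integer.DivMod using (a≡a%ℕn+[a/ℕn]*n; n%ℕd<d)
  open import Data.Integer.Divisibility.Signed
  open import Data.Integer.Tactic.RingSolver using (solve-∀)
  open import Data.Sum using (inj₁; inj₂)
  open import Level using (0ℓ)
  open import Relation.Binary.Bundles using (Setoid)
  import Relation.Binary.Reasoning.Setoid as SetoidReasoning
  open import Relation.Binary.PropositionalEquality
  open import Relation.Nullary using (contradiction)

  infix 4 _≋_[_]

  -- a ≋ b [ m ]: m divides a - b.  A record rather than a definition, so that
  -- a, b and m can be inferred from a proof of it.
  record _≋_[_] (a b m : ℤ) : Set where
    constructor mk≋
    field un≋ : m ∣ (a - b)
  open _≋_[_] public

  ∣-resp : ∀ {m x y} → x ≡ y → m ∣ x → m ∣ y
  ∣-resp refl d = d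

  1∣ : ∀ x → 1ℤ ∣ x
  1∣ x = divides x (sym (ℤP.*-identityʳ x))

  *-pres-∣ : ∀ {a b x y} → a ∣ x → b ∣ y → (a * b) ∣ (x * y)
  *-pres-∣ {a} {b} (divides q refl) (divides r refl) = divides (q * r) (lemma q a r b)
    where lemma : ∀ q a r b → q * a * (r * b) ≡ q * r * (a * b)
          lemma = solve-∀

  ≋-reflexive : ∀ {a b m} → a ≡ b → a ≋ b [ m ]
  ≋-reflexive {a} {m = m} refl = mk≋ (divides 0ℤ (lemma a m))
    where lemma : ∀ a m → a - a ≡ 0ℤ * m
          lemma = solve-∀

  ≋-refl : ∀ {a m} → a ≋ a [ m ]
  ≋-refl = ≋-reflexive refl

  ≋-sym : ∀ {a b m} → a ≋ b [ m ] → b ≋ a [ m ]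
  ≋-sym {a} {b} (mk≋ d) = mk≋ (∣-resp (lemma a b) (∣m⇒∣-m d))
    where lemma : ∀ a b → - (a - b) ≡ b - a
          lemma = solve-∀

  ≋-trans : ∀ {a b c m} → a ≋ b [ m ] → b ≋ c [ m ] → a ≋ c [ m ]
  ≋-trans {a} {b} {c} (mk≋ d) (mk≋ e) = mk≋ (∣-resp (lemma a b c) (∣m∣n⇒∣m+n d e))
    where lemma : ∀ a b c → (a - b) + (b - c) ≡ a - c
          lemma = solve-∀

  ≋-+ : ∀ {a b c d m} → a ≋ b [ m ] → c ≋ d [ m ] → a + c ≋ b + d [ m ]
  ≋-+ {a} {b} {c} {d} (mk≋ x) (mk≋ y) = mk≋ (∣-resp (lemma a b c d) (∣m∣n⇒∣m+n x y))
    where lemma : ∀ a b c d → (a - b) + (c - d) ≡ (a + c) - (b + d)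
          lemma = solve-∀

  ≋-* : ∀ {a b c d m} → a ≋ b [ m ] → c ≋ d [ m ] → a * c ≋ b * d [ m ]
  ≋-* {a} {b} {c} {d} (mk≋ x) (mk≋ y) =
    mk≋ (∣-resp (lemma a b c d) (∣m∣n⇒∣m+n (∣n⇒∣m*n a y) (∣m⇒∣m*n d x)))
    where lemma : ∀ a b c d → a * (c - d) + (a - b) * d ≡ a * c - b * d
          lemma = solve-∀

  ≋-+ˡ : ∀ c {a b m} → a ≋ b [ m ] → c + a ≋ c + b [ m ]
  ≋-+ˡ c = ≋-+ (≋-refl {c})

  ≋-*ˡ : ∀ c {a b m} → a ≋ b [ m ] → c * a ≋ c * b [ m ]
  ≋-*ˡ c = ≋-* (≋-refl {c})

  ≋-*ʳ : ∀ c {a b m} → a ≋ b [ m ] → a * c ≋ b * c [ m ]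
  ≋-*ʳ c a≋b = ≋-* a≋b (≋-refl {c})

  ≋-weaken : ∀ {a b m m'} → m ∣ m' → a ≋ b [ m' ] → a ≋ b [ m ]
  ≋-weaken m∣m' (mk≋ e) = mk≋ (∣-trans m∣m' e)

  ∣⇒≋0 : ∀ {x m} → m ∣ x → x ≋ 0ℤ [ m ]
  ∣⇒≋0 {x} d = mk≋ (∣-resp (sym (ℤP.+-identityʳ x)) d)

  ≋-∣ : ∀ {a b m} → a ≋ b [ m ] → m ∣ b → m ∣ a
  ≋-∣ {a} {b} (mk≋ d) e = ∣-resp (lemma a b) (∣m∣n⇒∣m+n d e)
    where lemma : ∀ a b → (a - b) + b ≡ a
          lemma = solve-∀

  ≋-setoid : ℤ → Setoid 0ℓ 0ℓ
  ≋-setoid m = record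
    { Carrier       = ℤ
    ; _≈_           = λ a b → a ≋ b [ m ]
    ; isEquivalence = record { refl = ≋-refl ; sym = ≋-sym ; trans = ≋-trans } }

  module ≋-Reasoning (m : ℤ) = SetoidReasoning (≋-setoid m)

  inverse-unique : ∀ {D u u' m} → D * u ≋ 1ℤ [ m ] → D * u' ≋ 1ℤ [ m ] → u ≋ u' [ m ]
  inverse-unique {D} {u} {u'} {m} Du≋1 Du'≋1 = begin
    u              ≡⟨ sym (ℤP.*-identityˡ u) ⟩
    1ℤ * u         ≈⟨ ≋-*ʳ u (≋-sym Du'≋1) ⟩
    D * u' * u     ≡⟨ lemma D u u' ⟩
    u' * (D * u)   ≈⟨ ≋-*ˡ u' Du≋1 ⟩
    u' * 1ℤ        ≡⟨ ℤP.*-identityʳ u' ⟩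
    u'             ∎
    where
    open ≋-Reasoning m
    lemma : ∀ D u u' → D * u' * u ≡ u' * (D * u)
    lemma = solve-∀

  %ℕ-≋ : ∀ x d .{{_ : NonZero d}} → + (x %ℕ d) ≋ x [ + d ]
  %ℕ-≋ x d = mk≋ (divides (- (x /ℕ d))
    (trans (cong (λ y → + (x %ℕ d) - y) (a≡a%ℕn+[a/ℕn]*n x d)) (lemma (+ (x %ℕ d)) (x /ℕ d) (+ d))))
    where lemma : ∀ r q d → r - (r + q * d) ≡ - q * d
          lemma = solve-∀

  ∣∧<⇒≡0 : ∀ {r d} → d ℕD.∣ r → r < d → r ≡ 0
  ∣∧<⇒≡0 {zero}  _   _   = refl
  ∣∧<⇒≡0 {suc r} d∣r r<d = contradiction d∣r (ℕD.>⇒∤ r<d)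

  /ℕ-exact : ∀ x d .{{_ : NonZero d}} → + d ∣ x → (x /ℕ d) * + d ≡ x
  /ℕ-exact x d d∣x = begin
    (x /ℕ d) * + d                ≡⟨ sym (ℤP.+-identityˡ _) ⟩
    + 0 + (x /ℕ d) * + d          ≡⟨ cong (λ r → + r + (x /ℕ d) * + d) (sym remainder≡0) ⟩
    + (x %ℕ d) + (x /ℕ d) * + d   ≡⟨ sym (a≡a%ℕn+[a/ℕn]*n x d) ⟩
    x                             ∎
    where
    open ≡-Reasoning
    remainder≡0 : x %ℕ d ≡ 0
    remainder≡0 = ∣∧<⇒≡0 (∣⇒∣ᵤ (≋-∣ (%ℕ-≋ x d) d∣x)) (n%ℕd<d x d)

  sumℤ-cong : ∀ {m} (f g : ℕ → ℤ) k → (∀ i → i < k → f i ≋ g i [ m ]) →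
              sumℤ f k ≋ sumℤ g k [ m ]
  sumℤ-cong f g zero    f≋g = ≋-refl
  sumℤ-cong f g (suc k) f≋g =
    ≋-+ (sumℤ-cong f g k (λ i i<k → f≋g i (ℕP.m<n⇒m<1+n i<k))) (f≋g k (ℕP.n<1+n k))

  sumℤ-*ˡ : ∀ u (f : ℕ → ℤ) k → sumℤ (λ i → u * f i) k ≡ u * sumℤ f k
  sumℤ-*ˡ u f zero    = sym (ℤP.*-zeroʳ u)
  sumℤ-*ˡ u f (suc k) =
    trans (cong (_+ u * f k) (sumℤ-*ˡ u f k)) (sym (ℤP.*-distribˡ-+ u (sumℤ f k) (f k)))

  eventually-constant : ∀ {m} (a : ℕ → ℤ) J₀ → (∀ J → J₀ ≤ J → a (suc J) ≋ a J [ m ]) →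
                        ∀ {J} → J₀ ≤ J → a J ≋ a J₀ [ m ]
  eventually-constant a J₀ next {zero}  z≤n = ≋-refl
  eventually-constant a J₀ next {suc J} J₀≤1+J with ℕP.m≤n⇒m<n∨m≡n J₀≤1+J
  ... | inj₁ (s≤s J₀≤J) = ≋-trans (next J J₀≤J) (eventually-constant a J₀ next J₀≤J)
  ... | inj₂ refl       = ≋-refl

-- Polynomials over ℤ as coefficient lists, constant term first.
module Polynomial where
  open import Data.Nat using (ℕ; zero; suc)
  open import Data.Integer using (ℤ; _+_; _*_; _-_; -_; 0ℤ; 1ℤ)
  import Data.Integer.Properties as ℤP
  open import Data.Integer.Divisibility.Signed
  open import Data.Integer.Tactic.RingSolver using (solve-∀)
  open import Data.List using (List; []; _∷_; drop)
  open import Relation.Binary.PropositionalEquality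
  open IntegerCongruence

  coeff : List ℤ → ℕ → ℤ
  coeff []      i       = 0ℤ
  coeff (a ∷ l) zero    = a
  coeff (a ∷ l) (suc i) = coeff l i

  eval : List ℤ → ℤ → ℤ
  eval []      x = 0ℤ
  eval (a ∷ l) x = a + x * eval l x

  add : List ℤ → List ℤ → List ℤ
  add []      m       = m
  add (a ∷ l) []      = a ∷ l
  add (a ∷ l) (b ∷ m) = (a + b) ∷ add l m

  scale : ℤ → List ℤ → List ℤ
  scale c []      = []
  scale c (a ∷ l) = (c * a) ∷ scale c l

  mulLinear : ℤ → List ℤ → List ℤ
  mulLinear a l = add (0ℤ ∷ l) (scale (- a) l)

  coeff-add : ∀ l m i → coeff (add l m) i ≡ coeff l i + coeff m i
  coeff-add []      m       i       = sym (ℤP.+-identityˡ (coeff m i))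
  coeff-add (a ∷ l) []      i       = sym (ℤP.+-identityʳ (coeff (a ∷ l) i))
  coeff-add (a ∷ l) (b ∷ m) zero    = refl
  coeff-add (a ∷ l) (b ∷ m) (suc i) = coeff-add l m i

  eval-add : ∀ l m x → eval (add l m) x ≡ eval l x + eval m x
  eval-add []      m       x = sym (ℤP.+-identityˡ (eval m x))
  eval-add (a ∷ l) []      x = sym (ℤP.+-identityʳ (eval (a ∷ l) x))
  eval-add (a ∷ l) (b ∷ m) x =
    trans (cong (λ e → a + b + x * e) (eval-add l m x)) (lemma a b x (eval l x) (eval m x))
    where lemma : ∀ a b x u v → a + b + x * (u + v) ≡ a + x * u + (b + x * v)
          lemma = solve-∀

  coeff-scale : ∀ c l i → coeff (scale c l) i ≡ c * coeff l i
  coeff-scale c []      i       = sym (ℤP.*-zeroʳ c)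
  coeff-scale c (a ∷ l) zero    = refl
  coeff-scale c (a ∷ l) (suc i) = coeff-scale c l i

  eval-scale : ∀ c l x → eval (scale c l) x ≡ c * eval l x
  eval-scale c []      x = sym (ℤP.*-zeroʳ c)
  eval-scale c (a ∷ l) x =
    trans (cong (λ e → c * a + x * e) (eval-scale c l x)) (lemma c a x (eval l x))
    where lemma : ∀ c a x u → c * a + x * (c * u) ≡ c * (a + x * u)
          lemma = solve-∀

  eval-mulLinear : ∀ a l x → eval (mulLinear a l) x ≡ (x - a) * eval l x
  eval-mulLinear a l x =
    trans (eval-add (0ℤ ∷ l) (scale (- a) l) x)
      (trans (cong (λ y → 0ℤ + x * eval l x + y) (eval-scale (- a) l x)) (lemma a x (eval l x)))
    where lemma : ∀ a x u → 0ℤ + x * u + (- a) * u ≡ (x - a) * u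
          lemma = solve-∀

  coeff-mulLinear-zero : ∀ a l → coeff (mulLinear a l) 0 ≡ - a * coeff l 0
  coeff-mulLinear-zero a l =
    trans (coeff-add (0ℤ ∷ l) (scale (- a) l) 0)
      (trans (ℤP.+-identityˡ _) (coeff-scale (- a) l 0))

  coeff-mulLinear-suc : ∀ a l i → coeff (mulLinear a l) (suc i) ≡ coeff l i + - a * coeff l (suc i)
  coeff-mulLinear-suc a l i =
    trans (coeff-add (0ℤ ∷ l) (scale (- a) l) (suc i)) (cong (λ y → coeff l i + y) (coeff-scale (- a) l (suc i)))

  eval≋coeff0 : ∀ l x → eval l x ≋ coeff l 0 [ x ]
  eval≋coeff0 []      x = ≋-refl
  eval≋coeff0 (a ∷ l) x = mk≋ (divides (eval l x) (lemma a x (eval l x)))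
    where lemma : ∀ a x u → a + x * u - a ≡ u * x
          lemma = solve-∀

  eval-drop : ∀ k l x → eval (drop k l) x ≡ coeff l k + x * eval (drop (suc k) l) x
  eval-drop zero    []      x = sym (trans (ℤP.+-identityˡ _) (ℤP.*-zeroʳ x))
  eval-drop (suc k) []      x = sym (trans (ℤP.+-identityˡ _) (ℤP.*-zeroʳ x))
  eval-drop zero    (a ∷ l) x = refl
  eval-drop (suc k) (a ∷ l) x = eval-drop k l x

  eval-split : ∀ l x (w : ℕ → ℤ) → w 0 ≡ 1ℤ → (∀ i → w (suc i) ≡ w i * x) →
               ∀ k → eval l x ≡ sumℤ (λ i → coeff l i * w i) k + w k * eval (drop k l) x
  eval-split l x w w0 ws zero =
    sym (trans (ℤP.+-identityˡ _) (trans (cong (_* eval l x) w0) (ℤP.*-identityˡ _)))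
  eval-split l x w w0 ws (suc k) = begin
    eval l x                                              ≡⟨ eval-split l x w w0 ws k ⟩
    s + w k * eval (drop k l) x                           ≡⟨ cong (λ e → s + w k * e) (eval-drop k l x) ⟩
    s + w k * (coeff l k + x * eval (drop (suc k) l) x)   ≡⟨ lemma s (coeff l k) (w k) x _ ⟩
    s + coeff l k * w k + w k * x * eval (drop (suc k) l) x
      ≡⟨ cong (λ e → s + coeff l k * w k + e * eval (drop (suc k) l) x) (sym (ws k)) ⟩
    s + coeff l k * w k + w (suc k) * eval (drop (suc k) l) x ∎
    where
    open ≡-Reasoning
    s : ℤ
    s = sumℤ (λ i → coeff l i * w i) k
    lemma : ∀ s c wk x e → s + wk * (c + x * e) ≡ s + c * wk + wk * x * e
    lemma = solve-∀

  truncation-≋ : ∀ l x (w : ℕ → ℤ) → w 0 ≡ 1ℤ → (∀ i → w (suc i) ≡ w i * x) →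
                 ∀ {m} k → m ∣ w k → sumℤ (λ i → coeff l i * w i) k ≋ eval l x [ m ]
  truncation-≋ l x w w0 ws k m∣wk =
    mk≋ (∣-resp tail-identity (∣m⇒∣-m (∣m⇒∣m*n (eval (drop k l) x) m∣wk)))
    where
    s : ℤ
    s = sumℤ (λ i → coeff l i * w i) k
    lemma : ∀ s wk t → - (wk * t) ≡ s - (s + wk * t)
    lemma = solve-∀
    tail-identity : - (w k * eval (drop k l) x) ≡ s - eval l x
    tail-identity = trans (lemma s (w k) _) (cong (λ y → s - y) (sym (eval-split l x w w0 ws k)))

module Powers (p : ℕ) where
  open import Data.Nat as ℕ using (ℕ; zero; suc; _≤_; _<_; _∸_)
  import Data.Nat.Properties as ℕP
  open import Data.Nat.ListAction using (sum)
  open import Data.Integer using (ℤ; +_; _+_; _*_; _-_; -_; 0ℤ; 1ℤ)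
  import Data.Integer.Properties as ℤP
  open import Data.Integer.Divisibility.Signed
  open import Data.Integer.Tactic.RingSolver using (solve-∀)
  open import Data.List using (List; []; _∷_; length)
  open import Data.List.Relation.Unary.All using (All; []; _∷_)
  open import Data.List.Relation.Unary.Any using (here; there)
  open import Data.List.Membership.Propositional using (_∈_)
  open import Relation.Binary.PropositionalEquality
  open IntegerCongruence
  open Polynomial

  P : ℕ → ℤ
  P k = + (p ℕ.^ k)

  P-+ : ∀ a b → P (a ℕ.+ b) ≡ P a * P b
  P-+ a b = trans (cong +_ (ℕP.^-distribˡ-+-* p a b)) (ℤP.pos-* (p ℕ.^ a) (p ℕ.^ b))

  P-∣ : ∀ {a b} → a ≤ b → P a ∣ P b
  P-∣ {a} {b} a≤b = divides (P (b ∸ a))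
    (trans (cong P (sym (ℕP.m+[n∸m]≡n a≤b))) (trans (P-+ a (b ∸ a)) (ℤP.*-comm (P a) (P (b ∸ a)))))

  geometric : ℕ → ℕ → ℤ
  geometric d k = sumℤ (λ t → P (d ℕ.* t)) k

  geometric-sum : ∀ d k → (P d - 1ℤ) * geometric d k ≡ P (d ℕ.* k) - 1ℤ
  geometric-sum d zero = begin
    (P d - 1ℤ) * 0ℤ   ≡⟨ ℤP.*-zeroʳ (P d - 1ℤ) ⟩
    P 0 - 1ℤ          ≡⟨ cong (λ e → P e - 1ℤ) (sym (ℕP.*-zeroʳ d)) ⟩
    P (d ℕ.* 0) - 1ℤ  ∎
    where open ≡-Reasoning
  geometric-sum d (suc k) = begin
    (P d - 1ℤ) * (geometric d k + P (d ℕ.* k))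
      ≡⟨ ℤP.*-distribˡ-+ (P d - 1ℤ) (geometric d k) (P (d ℕ.* k)) ⟩
    (P d - 1ℤ) * geometric d k + (P d - 1ℤ) * P (d ℕ.* k)
      ≡⟨ cong (_+ (P d - 1ℤ) * P (d ℕ.* k)) (geometric-sum d k) ⟩
    P (d ℕ.* k) - 1ℤ + (P d - 1ℤ) * P (d ℕ.* k)
      ≡⟨ lemma (P d) (P (d ℕ.* k)) ⟩
    P d * P (d ℕ.* k) - 1ℤ
      ≡⟨ cong (_- 1ℤ) (sym (trans (cong P (ℕP.*-suc d k)) (P-+ d (d ℕ.* k)))) ⟩
    P (d ℕ.* suc k) - 1ℤ ∎
    where
    open ≡-Reasoning
    lemma : ∀ x y → (y - 1ℤ) + (x - 1ℤ) * y ≡ x * y - 1ℤ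
    lemma = solve-∀

  geometric-inverse : ∀ d k → 1 ≤ d → (P d - 1ℤ) * (- geometric d k) ≋ 1ℤ [ P k ]
  geometric-inverse d k 1≤d =
    mk≋ (∣-resp identity (∣m⇒∣-m (P-∣ (ℕP.m≤n*m k d {{ℕ.>-nonZero 1≤d}}))))
    where
    open ≡-Reasoning
    lemma₁ : ∀ y → - y ≡ - (y - 1ℤ) - 1ℤ
    lemma₁ = solve-∀
    lemma₂ : ∀ x g → - ((x - 1ℤ) * g) - 1ℤ ≡ (x - 1ℤ) * (- g) - 1ℤ
    lemma₂ = solve-∀
    identity : - P (d ℕ.* k) ≡ (P d - 1ℤ) * (- geometric d k) - 1ℤ
    identity = begin
      - P (d ℕ.* k)                          ≡⟨ lemma₁ (P (d ℕ.* k)) ⟩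
      - (P (d ℕ.* k) - 1ℤ) - 1ℤ              ≡⟨ cong (λ y → - y - 1ℤ) (sym (geometric-sum d k)) ⟩
      - ((P d - 1ℤ) * geometric d k) - 1ℤ    ≡⟨ lemma₂ (P d) (geometric d k) ⟩
      (P d - 1ℤ) * (- geometric d k) - 1ℤ    ∎

  nodePoly : List ℕ → List ℤ
  nodePoly []       = 1ℤ ∷ []
  nodePoly (a ∷ as) = mulLinear (P a) (nodePoly as)

  nodeUnit : List ℕ → ℕ → ℤ
  nodeUnit []       m = 1ℤ
  nodeUnit (a ∷ as) m = (P (m ∸ a) - 1ℤ) * nodeUnit as m

  nodeUnitInv : List ℕ → ℕ → ℕ → ℤ
  nodeUnitInv []       m k = 1ℤ
  nodeUnitInv (a ∷ as) m k = (- geometric (m ∸ a) k) * nodeUnitInv as m k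

  nodeUnit-inverse : ∀ {as m} k → All (_< m) as → nodeUnit as m * nodeUnitInv as m k ≋ 1ℤ [ P k ]
  nodeUnit-inverse k [] = ≋-refl
  nodeUnit-inverse {a ∷ as} {m} k (a<m ∷ as<m) = begin
    (P (m ∸ a) - 1ℤ) * nodeUnit as m * (- geometric (m ∸ a) k * nodeUnitInv as m k)
      ≡⟨ lemma (P (m ∸ a) - 1ℤ) (nodeUnit as m) (- geometric (m ∸ a) k) (nodeUnitInv as m k) ⟩
    (P (m ∸ a) - 1ℤ) * (- geometric (m ∸ a) k) * (nodeUnit as m * nodeUnitInv as m k)
      ≈⟨ ≋-* (geometric-inverse (m ∸ a) k (ℕP.m<n⇒0<n∸m a<m)) (nodeUnit-inverse k as<m) ⟩
    1ℤ * 1ℤ ∎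
    where
    open ≋-Reasoning (P k)
    lemma : ∀ x r y s → x * r * (y * s) ≡ x * y * (r * s)
    lemma = solve-∀

  nodePoly-at-later : ∀ {as m} → All (_≤ m) as → eval (nodePoly as) (P m) ≡ P (sum as) * nodeUnit as m
  nodePoly-at-later {[]} {m} [] = cong (λ y → 1ℤ + y) (ℤP.*-zeroʳ (P m))
  nodePoly-at-later {a ∷ as} {m} (a≤m ∷ as≤m) = begin
    eval (mulLinear (P a) (nodePoly as)) (P m)       ≡⟨ eval-mulLinear (P a) (nodePoly as) (P m) ⟩
    (P m - P a) * eval (nodePoly as) (P m)
      ≡⟨ cong₂ (λ u v → (u - P a) * v) p^m-split (nodePoly-at-later as≤m) ⟩
    (P a * P (m ∸ a) - P a) * (P (sum as) * nodeUnit as m)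
      ≡⟨ lemma (P a) (P (m ∸ a)) (P (sum as)) (nodeUnit as m) ⟩
    P a * P (sum as) * ((P (m ∸ a) - 1ℤ) * nodeUnit as m)
      ≡⟨ cong (_* ((P (m ∸ a) - 1ℤ) * nodeUnit as m)) (sym (P-+ a (sum as))) ⟩
    P (a ℕ.+ sum as) * nodeUnit (a ∷ as) m ∎
    where
    open ≡-Reasoning
    p^m-split : P m ≡ P a * P (m ∸ a)
    p^m-split = trans (cong P (sym (ℕP.m+[n∸m]≡n a≤m))) (P-+ a (m ∸ a))
    lemma : ∀ x y s r → (x * y - x) * (s * r) ≡ x * s * ((y - 1ℤ) * r)
    lemma = solve-∀

  nodePoly-root : ∀ {as a} → a ∈ as → eval (nodePoly as) (P a) ≡ 0ℤ
  nodePoly-root {b ∷ as} {a} (here refl) =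
    trans (eval-mulLinear (P a) (nodePoly as) (P a))
      (trans (cong (_* eval (nodePoly as) (P a)) (ℤP.+-inverseʳ (P a))) (ℤP.*-zeroˡ (eval (nodePoly as) (P a))))
  nodePoly-root {b ∷ as} {a} (there a∈as) =
    trans (eval-mulLinear (P b) (nodePoly as) (P a))
      (trans (cong ((P a - P b) *_) (nodePoly-root a∈as)) (ℤP.*-zeroʳ (P a - P b)))

  -- With all nodes and m positive, every factor p^m - p^a is divisible by p,
  -- so the value at p^m is divisible by p^{#as}.
  nodePoly-value-∣ : ∀ {as m} → All (1 ≤_) as → 1 ≤ m → P (length as) ∣ eval (nodePoly as) (P m)
  nodePoly-value-∣ {[]}     []            _   = 1∣ _
  nodePoly-value-∣ {a ∷ as} {m} (1≤a ∷ 1≤as) 1≤m =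
    subst₂ _∣_ (sym (P-+ 1 (length as))) (sym (eval-mulLinear (P a) (nodePoly as) (P m)))
      (*-pres-∣ (∣m∣n⇒∣m-n (P-∣ 1≤m) (P-∣ 1≤a)) (nodePoly-value-∣ 1≤as 1≤m))

  ∸-suc-bound : ∀ m n → m ∸ n ≤ suc (m ∸ suc n)
  ∸-suc-bound zero    zero    = ℕ.z≤n
  ∸-suc-bound zero    (suc n) = ℕ.z≤n
  ∸-suc-bound (suc m) zero    = ℕP.≤-refl
  ∸-suc-bound (suc m) (suc n) = ∸-suc-bound m n

  nodePoly-coeff-∣ : ∀ {as} → All (1 ≤_) as → ∀ i → P (length as ∸ i) ∣ coeff (nodePoly as) i
  nodePoly-coeff-∣ {[]} [] i = subst (_∣ coeff (nodePoly []) i) (cong P (sym (ℕP.0∸n≡0 i))) (1∣ _)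
  nodePoly-coeff-∣ {a ∷ as} (1≤a ∷ 1≤as) zero =
    subst₂ _∣_ (sym (P-+ 1 (length as))) (sym (coeff-mulLinear-zero (P a) (nodePoly as)))
      (*-pres-∣ (∣m⇒∣-m (P-∣ 1≤a)) (nodePoly-coeff-∣ 1≤as zero))
  nodePoly-coeff-∣ {a ∷ as} (1≤a ∷ 1≤as) (suc i) =
    ∣-resp (sym (coeff-mulLinear-suc (P a) (nodePoly as) i))
      (∣m∣n⇒∣m+n (nodePoly-coeff-∣ 1≤as i)
        (∣-trans (P-∣ (∸-suc-bound (length as) i))
          (subst (_∣ (- P a * coeff (nodePoly as) (suc i))) (sym (P-+ 1 (length as ∸ suc i)))
            (*-pres-∣ (∣m⇒∣-m (P-∣ 1≤a)) (nodePoly-coeff-∣ 1≤as (suc i))))))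

module Construction (p : ℕ) (1<p : 1 < p) (n₁ : ℕ) (1≤n₁ : 1 ≤ n₁) where
  open import Data.Nat as ℕ using (ℕ; zero; suc; _≤_; _<_; _∸_; z≤n; s≤s; NonZero)
  import Data.Nat.Properties as ℕP
  import Data.Nat.Divisibility as ℕD
  open import Data.Nat.ListAction using (sum)
  open import Data.Integer using (ℤ; +_; _+_; _*_; _-_; 0ℤ; 1ℤ; _%ℕ_; _/ℕ_)
  import Data.Integer.Properties as ℤP
  open import Data.Integer.DivMod using (n%ℕd<d)
  open import Data.Integer.Divisibility.Signed
  open import Data.Integer.Tactic.RingSolver using (solve-∀)
  open import Data.List using (List; []; _∷_; length)
  open import Data.List.Relation.Unary.All as All using (All; []; _∷_)
  open import Data.List.Relation.Unary.Any using (here; there)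
  open import Data.List.Membership.Propositional using (_∈_)
  open import Data.Sum using (inj₁; inj₂)
  open import Relation.Binary.PropositionalEquality
  open IntegerCongruence
  open Polynomial
  open Powers p

  instance
    p-nonZero : NonZero p
    p-nonZero = ℕ.>-nonZero (ℕP.<⇒≤ 1<p)

  p^-nonZero : ∀ k → NonZero (p ℕ.^ k)
  p^-nonZero k = ℕP.m^n≢0 p k

  n<p^n : ∀ n → n < p ℕ.^ n
  n<p^n zero    = s≤s z≤n
  n<p^n (suc n) = ℕP.≤-<-trans (n<p^n n) (ℕP.^-monoʳ-< p 1<p (ℕP.n<1+n n))

  multiple-below-power : ∀ V n S → n ≤ S → p ℕ.^ n ℕD.∣ V → V < p ℕ.^ S → V ℕ.+ p ℕ.^ n ≤ p ℕ.^ S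
  multiple-below-power V n S n≤S (ℕD.divides a refl) V<p^S = begin
    a ℕ.* p ℕ.^ n ℕ.+ p ℕ.^ n      ≡⟨ ℕP.+-comm (a ℕ.* p ℕ.^ n) (p ℕ.^ n) ⟩
    suc a ℕ.* p ℕ.^ n              ≤⟨ ℕP.*-monoˡ-≤ (p ℕ.^ n) a<p^[S∸n] ⟩
    p ℕ.^ (S ∸ n) ℕ.* p ℕ.^ n      ≡⟨ sym p^S-split ⟩
    p ℕ.^ S                        ∎
    where
    open ℕP.≤-Reasoning
    p^S-split : p ℕ.^ S ≡ p ℕ.^ (S ∸ n) ℕ.* p ℕ.^ n
    p^S-split = trans (cong (p ℕ.^_) (sym (ℕP.m∸n+n≡m n≤S))) (ℕP.^-distribˡ-+-* p (S ∸ n) n)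
    a<p^[S∸n] : a < p ℕ.^ (S ∸ n)
    a<p^[S∸n] = ℕP.*-cancelʳ-< (p ℕ.^ n) a (p ℕ.^ (S ∸ n)) (subst (a ℕ.* p ℕ.^ n <_) p^S-split V<p^S)

  -- A stage: the newest node, the older nodes (newest first) and the
  -- approximant G/D (G = numer, D = denom), with denom⁻¹ k inverse to D mod p^k.
  record Stage : Set where
    field
      newest  : ℕ
      older   : List ℕ
      numer   : List ℤ
      denom   : ℤ
      denom⁻¹ : ℕ → ℤ
  open Stage public

  nodes : Stage → List ℕ
  nodes s = newest s ∷ older s

  nodeSum : Stage → ℕ
  nodeSum s = sum (nodes s)

  valueAt0 : Stage → ℤ
  valueAt0 s = coeff (numer s) 0 * denom⁻¹ s (nodeSum s)

  -- The residue 0 ≤ V < p^S with n + p^n + V ≡ G(0)/D (mod p^S), n the newest node.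
  offset : Stage → ℕ
  offset s = ((valueAt0 s - + newest s - P (newest s)) %ℕ (p ℕ.^ nodeSum s)) {{p^-nonZero (nodeSum s)}}

  nextNode : Stage → ℕ
  nextNode s = newest s ℕ.+ p ℕ.^ newest s ℕ.+ offset s

  -- R, with ∏_a (p^N - p^a) = p^S·R for the next node N.
  rescale : Stage → ℤ
  rescale s = nodeUnit (nodes s) (nextNode s)

  -- N·D - G(p^N), a multiple of p^S; the correction q is the quotient.
  defect : Stage → ℤ
  defect s = + nextNode s * denom s - eval (numer s) (P (nextNode s))

  correction : Stage → ℤ
  correction s = (defect s /ℕ (p ℕ.^ nodeSum s)) {{p^-nonZero (nodeSum s)}}

  step : Stage → Stage
  step s = record
    { newest  = nextNode s
    ; older   = nodes s
    ; numer   = add (scale (rescale s) (numer s)) (scale (correction s) (nodePoly (nodes s)))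
    ; denom   = rescale s * denom s
    ; denom⁻¹ = λ k → denom⁻¹ s k * nodeUnitInv (nodes s) (nextNode s) k }

  initial : Stage
  initial = record { newest = n₁ ; older = [] ; numer = + n₁ ∷ [] ; denom = 1ℤ ; denom⁻¹ = λ _ → 1ℤ }

  stage : ℕ → Stage
  stage zero    = initial
  stage (suc J) = step (stage J)

  -- The j-th node (the paper's n_{j+1}).
  node : ℕ → ℕ
  node j = newest (stage j)

  coeff-step : ∀ s i → coeff (numer (step s)) i ≡
               rescale s * coeff (numer s) i + correction s * coeff (nodePoly (nodes s)) i
  coeff-step s i = trans (coeff-add (scale (rescale s) (numer s)) (scale (correction s) (nodePoly (nodes s))) i)
    (cong₂ _+_ (coeff-scale (rescale s) (numer s) i) (coeff-scale (correction s) (nodePoly (nodes s)) i))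

  eval-step : ∀ s x → eval (numer (step s)) x ≡
              rescale s * eval (numer s) x + correction s * eval (nodePoly (nodes s)) x
  eval-step s x = trans (eval-add (scale (rescale s) (numer s)) (scale (correction s) (nodePoly (nodes s))) x)
    (cong₂ _+_ (eval-scale (rescale s) (numer s) x) (eval-scale (correction s) (nodePoly (nodes s)) x))

  nextNode-lower : ∀ s → newest s ℕ.+ p ℕ.^ newest s ≤ nextNode s
  nextNode-lower s = ℕP.m≤m+n _ (offset s)

  newest<nextNode : ∀ s → newest s < nextNode s
  newest<nextNode s = ℕP.<-≤-trans (ℕP.m<m+n (newest s) (ℕP.m^n>0 p (newest s))) (nextNode-lower s)

  newest≤nodeSum : ∀ s → newest s ≤ nodeSum s
  newest≤nodeSum s = ℕP.m≤m+n (newest s) (sum (older s))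

  record Valid (s : Stage) : Set where
    field
      positive     : ∀ {a} → a ∈ nodes s → 1 ≤ a
      below-newest : ∀ {a} → a ∈ older s → a < newest s
      interpolates : ∀ {a} → a ∈ nodes s → eval (numer s) (P a) ≡ denom s * + a
      invertible   : ∀ k → denom s * denom⁻¹ s k ≋ 1ℤ [ P k ]
      sum-bound    : nodeSum s ≤ newest s ℕ.+ p ℕ.^ newest s

  valid-initial : Valid initial
  valid-initial = record
    { positive     = λ { (here refl) → 1≤n₁ }
    ; below-newest = λ { () }
    ; interpolates = λ { (here refl) → trans (cong (λ y → + n₁ + y) (ℤP.*-zeroʳ (P n₁)))
                                                   (trans (ℤP.+-identityʳ (+ n₁)) (sym (ℤP.*-identityˡ (+ n₁)))) }
    ; invertible   = λ k → ≋-refl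
    ; sum-bound    = ℕP.+-monoʳ-≤ n₁ z≤n }

  module ValidStage {s : Stage} (V : Valid s) where
    open Valid V

    n S N : ℕ
    n = newest s
    S = nodeSum s
    N = nextNode s

    nodeSum≤nextNode : S ≤ N
    nodeSum≤nextNode = ℕP.≤-trans sum-bound (nextNode-lower s)

    nodes<nextNode : ∀ {a} → a ∈ nodes s → a < N
    nodes<nextNode (here refl)     = newest<nextNode s
    nodes<nextNode (there a∈older) = ℕP.<-trans (below-newest a∈older) (newest<nextNode s)

    denom⁻¹-coherent : ∀ k → denom⁻¹ s (suc k) ≋ denom⁻¹ s k [ P k ]
    denom⁻¹-coherent k = inverse-unique {denom s} (≋-weaken (P-∣ (ℕP.n≤1+n k)) (invertible (suc k))) (invertible k)

    -- G(0)/D ≡ n (mod p^n), since G(0) ≡ G(p^n) = D·n (mod p^n) and n ≤ S.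
    valueAt0≋newest : valueAt0 s ≋ + n [ P n ]
    valueAt0≋newest = begin
      coeff (numer s) 0 * u       ≈⟨ ≋-*ʳ u (≋-sym (eval≋coeff0 (numer s) (P n))) ⟩
      eval (numer s) (P n) * u    ≡⟨ cong (_* u) (interpolates (here refl)) ⟩
      denom s * + n * u           ≡⟨ lemma (denom s) (+ n) u ⟩
      denom s * u * + n           ≈⟨ ≋-*ʳ (+ n) (≋-weaken (P-∣ (newest≤nodeSum s)) (invertible S)) ⟩
      1ℤ * + n                    ≡⟨ ℤP.*-identityˡ (+ n) ⟩
      + n                         ∎
      where
      open ≋-Reasoning (P n)
      u : ℤ
      u = denom⁻¹ s S
      lemma : ∀ D n u → D * n * u ≡ D * u * n
      lemma = solve-∀

    nextNode≋valueAt0 : + N ≋ valueAt0 s [ P S ]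
    nextNode≋valueAt0 = begin
      + N                                   ≡⟨ split ⟩
      + n + P n + + offset s                ≈⟨ ≋-+ˡ (+ n + P n) (%ℕ-≋ (valueAt0 s - + n - P n) (p ℕ.^ S) {{p^-nonZero S}}) ⟩
      + n + P n + (valueAt0 s - + n - P n)  ≡⟨ lemma (valueAt0 s) (+ n) (P n) ⟩
      valueAt0 s                            ∎
      where
      open ≋-Reasoning (P S)
      split : + N ≡ + n + P n + + offset s
      split = trans (ℤP.pos-+ (n ℕ.+ p ℕ.^ n) (offset s)) (cong (_+ + offset s) (ℤP.pos-+ n (p ℕ.^ n)))
      lemma : ∀ t n m → n + m + (t - n - m) ≡ t
      lemma = solve-∀

    -- Hence p^n divides the offset, so offset + p^n ≤ p^S.
    offset-bound : offset s ℕ.+ p ℕ.^ n ≤ p ℕ.^ S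
    offset-bound =
      multiple-below-power (offset s) n S (newest≤nodeSum s) (∣⇒∣ᵤ p^n∣offset) (n%ℕd<d (valueAt0 s - + n - P n) (p ℕ.^ S) {{p^-nonZero S}})
      where
      p^n∣offset : P n ∣ + offset s
      p^n∣offset = ≋-∣ (≋-weaken (P-∣ (newest≤nodeSum s)) (%ℕ-≋ _ (p ℕ.^ S) {{p^-nonZero S}}))
                       (∣m∣n⇒∣m-n (un≋ valueAt0≋newest) ∣-refl)

    nextNode-upper : N ≤ n ℕ.+ p ℕ.^ S
    nextNode-upper = begin
      n ℕ.+ p ℕ.^ n ℕ.+ offset s     ≡⟨ ℕP.+-assoc n (p ℕ.^ n) (offset s) ⟩
      n ℕ.+ (p ℕ.^ n ℕ.+ offset s)   ≡⟨ cong (n ℕ.+_) (ℕP.+-comm (p ℕ.^ n) (offset s)) ⟩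
      n ℕ.+ (offset s ℕ.+ p ℕ.^ n)   ≤⟨ ℕP.+-monoʳ-≤ n offset-bound ⟩
      n ℕ.+ p ℕ.^ S                  ∎
      where open ℕP.≤-Reasoning

    -- p^S divides N·D - G(p^N): N·D ≡ G(0)·D⁻¹·D ≡ G(0) ≡ G(p^N) (mod p^S), as S ≤ N.
    p^S∣defect : P S ∣ defect s
    p^S∣defect = un≋ (begin
      + N * denom s                      ≈⟨ ≋-*ʳ (denom s) nextNode≋valueAt0 ⟩
      coeff G 0 * denom⁻¹ s S * denom s  ≡⟨ lemma (coeff G 0) (denom⁻¹ s S) (denom s) ⟩
      coeff G 0 * (denom s * denom⁻¹ s S) ≈⟨ ≋-*ˡ (coeff G 0) (invertible S) ⟩
      coeff G 0 * 1ℤ                     ≡⟨ ℤP.*-identityʳ (coeff G 0) ⟩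
      coeff G 0                          ≈⟨ ≋-sym (≋-weaken (P-∣ nodeSum≤nextNode) (eval≋coeff0 G (P N))) ⟩
      eval G (P N)                       ∎)
      where
      open ≋-Reasoning (P S)
      G : List ℤ
      G = numer s
      lemma : ∀ g u D → g * u * D ≡ g * (D * u)
      lemma = solve-∀

    correction-exact : correction s * P S ≡ defect s
    correction-exact = /ℕ-exact (defect s) (p ℕ.^ S) {{p^-nonZero S}} p^S∣defect

    interpolates-next : eval (numer (step s)) (P N) ≡ rescale s * denom s * + N
    interpolates-next = begin
      eval (numer (step s)) (P N)                 ≡⟨ eval-step s (P N) ⟩
      R * E + q * eval (nodePoly (nodes s)) (P N)
        ≡⟨ cong (λ y → R * E + q * y) (nodePoly-at-later (All.tabulate (λ a∈ → ℕP.<⇒≤ (nodes<nextNode a∈)))) ⟩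
      R * E + q * (P S * R)                       ≡⟨ lemma₁ R E q (P S) ⟩
      R * E + q * P S * R                         ≡⟨ cong (λ y → R * E + y * R) correction-exact ⟩
      R * E + (+ N * denom s - E) * R             ≡⟨ lemma₂ R E (+ N) (denom s) ⟩
      R * denom s * + N                           ∎
      where
      open ≡-Reasoning
      R q E : ℤ
      R = rescale s
      q = correction s
      E = eval (numer s) (P N)
      lemma₁ : ∀ R E q m → R * E + q * (m * R) ≡ R * E + q * m * R
      lemma₁ = solve-∀
      lemma₂ : ∀ R E n D → R * E + (n * D - E) * R ≡ R * D * n
      lemma₂ = solve-∀

    interpolates-old : ∀ {a} → a ∈ nodes s → eval (numer (step s)) (P a) ≡ rescale s * denom s * + a
    interpolates-old {a} a∈ = begin
      eval (numer (step s)) (P a)          ≡⟨ eval-step s (P a) ⟩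
      R * eval (numer s) (P a) + q * eval (nodePoly (nodes s)) (P a)
        ≡⟨ cong₂ (λ y z → R * y + q * z) (interpolates a∈) (nodePoly-root a∈) ⟩
      R * (denom s * + a) + q * 0ℤ         ≡⟨ lemma R (denom s) (+ a) q ⟩
      R * denom s * + a                    ∎
      where
      open ≡-Reasoning
      R q : ℤ
      R = rescale s
      q = correction s
      lemma : ∀ R D a q → R * (D * a) + q * 0ℤ ≡ R * D * a
      lemma = solve-∀

    valid-step : Valid (step s)
    valid-step = record
      { positive     = λ { (here refl) → ℕP.≤-trans (positive (here refl)) (ℕP.<⇒≤ (newest<nextNode s))
                         ; (there a∈) → positive a∈ }
      ; below-newest = nodes<nextNode
      ; interpolates = λ { (here refl) → interpolates-next ; (there a∈) → interpolates-old a∈ }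
      ; invertible   = invertible-next
      ; sum-bound    = ℕP.+-monoʳ-≤ N (ℕP.≤-trans nodeSum≤nextNode (ℕP.<⇒≤ (n<p^n N))) }
      where
      invertible-next : ∀ k → rescale s * denom s * (denom⁻¹ s k * nodeUnitInv (nodes s) N k) ≋ 1ℤ [ P k ]
      invertible-next k = begin
        R * denom s * (denom⁻¹ s k * r)     ≡⟨ lemma R (denom s) (denom⁻¹ s k) r ⟩
        denom s * denom⁻¹ s k * (R * r)     ≈⟨ ≋-* (invertible k) (nodeUnit-inverse k (All.tabulate nodes<nextNode)) ⟩
        1ℤ * 1ℤ                             ∎
        where
        open ≋-Reasoning (P k)
        R r : ℤ
        R = rescale s
        r = nodeUnitInv (nodes s) N k
        lemma : ∀ R D d r → R * D * (d * r) ≡ D * d * (R * r)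
        lemma = solve-∀

  valid : ∀ J → Valid (stage J)
  valid zero    = valid-initial
  valid (suc J) = ValidStage.valid-step (valid J)

  node-positive : ∀ j → 1 ≤ node j
  node-positive j = Valid.positive (valid j) (here refl)

  length-nodes : ∀ J → length (nodes (stage J)) ≡ suc J
  length-nodes zero    = refl
  length-nodes (suc J) = cong suc (length-nodes J)

  node∈ : ∀ {j J} → j ≤ J → node j ∈ nodes (stage J)
  node∈ {j} {zero}  z≤n = here refl
  node∈ {j} {suc J} j≤1+J with ℕP.m≤n⇒m<n∨m≡n j≤1+J
  ... | inj₁ (s≤s j≤J) = there (node∈ j≤J)
  ... | inj₂ refl      = here refl

  normalisedCoeff : ℕ → ℕ → ℕ → ℤ
  normalisedCoeff i k J = coeff (numer (stage J)) i * denom⁻¹ (stage J) k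

  normalisedValue : ℕ → ℕ → ℕ → ℤ
  normalisedValue m k J = eval (numer (stage J)) (P m) * denom⁻¹ (stage J) k

  -- Passing from stage J to J+1 turns X·D⁻¹ into (R·X + q·Y)·D⁻¹·R⁻¹, which is
  -- congruent to X·D⁻¹ modulo p^k when p^k divides Y.
  step-negligible : ∀ J k X Y → P k ∣ Y →
    (rescale (stage J) * X + correction (stage J) * Y) * denom⁻¹ (stage (suc J)) k
      ≋ X * denom⁻¹ (stage J) k [ P k ]
  step-negligible J k X Y p^k∣Y = begin
    (R * X + q * Y) * (d * r)      ≈⟨ ≋-*ʳ (d * r) (≋-+ˡ (R * X) (≋-*ˡ q (∣⇒≋0 p^k∣Y))) ⟩
    (R * X + q * 0ℤ) * (d * r)     ≡⟨ lemma R X q d r ⟩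
    X * d * (R * r)                ≈⟨ ≋-*ˡ (X * d) (nodeUnit-inverse k (All.tabulate (ValidStage.nodes<nextNode (valid J)))) ⟩
    X * d * 1ℤ                     ≡⟨ ℤP.*-identityʳ (X * d) ⟩
    X * d                          ∎
    where
    open ≋-Reasoning (P k)
    R q d r : ℤ
    R = rescale (stage J)
    q = correction (stage J)
    d = denom⁻¹ (stage J) k
    r = nodeUnitInv (nodes (stage J)) (nextNode (stage J)) k
    lemma : ∀ R X q d r → (R * X + q * 0ℤ) * (d * r) ≡ X * d * (R * r)
    lemma = solve-∀

  -- Coefficient i changes by a multiple of p^{J+1-i} from stage J to J+1 ...
  normalisedCoeff-step : ∀ J i k → k ℕ.+ i ≤ suc J →
    normalisedCoeff i k (suc J) ≋ normalisedCoeff i k J [ P k ]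
  normalisedCoeff-step J i k k+i≤1+J =
    ≋-trans (≋-reflexive (cong (_* denom⁻¹ (stage (suc J)) k) (coeff-step (stage J) i)))
      (step-negligible J k _ _ (∣-trans (P-∣ k≤length∸i) (nodePoly-coeff-∣ (All.tabulate (Valid.positive (valid J))) i)))
    where
    k≤length∸i : k ≤ length (nodes (stage J)) ∸ i
    k≤length∸i = subst (λ l → k ≤ l ∸ i) (sym (length-nodes J)) (ℕP.m+n≤o⇒m≤o∸n k k+i≤1+J)

  -- ... and the value at p^m (m ≥ 1) by a multiple of p^{J+1}.
  normalisedValue-step : ∀ m k J → 1 ≤ m → k ≤ suc J →
    normalisedValue m k (suc J) ≋ normalisedValue m k J [ P k ]
  normalisedValue-step m k J 1≤m k≤1+J =
    ≋-trans (≋-reflexive (cong (_* denom⁻¹ (stage (suc J)) k) (eval-step (stage J) (P m))))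
      (step-negligible J k _ _ (∣-trans (P-∣ k≤length) (nodePoly-value-∣ (All.tabulate (Valid.positive (valid J))) 1≤m)))
    where
    k≤length : k ≤ length (nodes (stage J))
    k≤length = subst (k ≤_) (sym (length-nodes J)) k≤1+J

  normalisedCoeff-stable : ∀ i k {J} → k ℕ.+ i ≤ J →
    normalisedCoeff i k J ≋ normalisedCoeff i k (k ℕ.+ i) [ P k ]
  normalisedCoeff-stable i k = eventually-constant (normalisedCoeff i k) (k ℕ.+ i)
    (λ J k+i≤J → normalisedCoeff-step J i k (ℕP.m≤n⇒m≤1+n k+i≤J))

  -- Modulo p^k, the value of G_J/D_J at p^{n_j} is n_j once k ≤ J + 1: follow
  -- it to a stage where n_j is a node.
  value-at-node : ∀ j k J → k ≤ suc J → normalisedValue (node j) k J ≋ + node j [ P k ]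
  value-at-node j k J k≤1+J = begin
    normalisedValue (node j) k J
      ≈⟨ ≋-sym (eventually-constant (normalisedValue (node j) k) J
                  (λ J' J≤J' → normalisedValue-step (node j) k J' (node-positive j) (ℕP.≤-trans k≤1+J (s≤s J≤J')))
                  (ℕP.m≤m+n J j)) ⟩
    eval (numer (stage J')) (P (node j)) * d
      ≡⟨ cong (_* d) (Valid.interpolates (valid J') (node∈ (ℕP.m≤n+m j J))) ⟩
    denom (stage J') * + node j * d   ≡⟨ lemma (denom (stage J')) (+ node j) d ⟩
    denom (stage J') * d * + node j   ≈⟨ ≋-*ʳ (+ node j) (Valid.invertible (valid J') k) ⟩
    1ℤ * + node j                     ≡⟨ ℤP.*-identityˡ (+ node j) ⟩
    + node j                          ∎
    where
    open ≋-Reasoning (P k)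
    J' : ℕ
    J' = J ℕ.+ j
    d : ℤ
    d = denom⁻¹ (stage J') k
    lemma : ∀ D n d → D * n * d ≡ D * d * n
    lemma = solve-∀

  coefficient : ℕ → ℕ → ℤ
  coefficient i k = normalisedCoeff i k (k ℕ.+ i)

  coefficient-compatible : ∀ i k → coefficient i (suc k) ≋ coefficient i k [ P k ]
  coefficient-compatible i k =
    ≋-trans (≋-*ˡ (coeff (numer (stage (suc (k ℕ.+ i)))) i) (ValidStage.denom⁻¹-coherent (valid (suc (k ℕ.+ i))) k))
      (normalisedCoeff-step (k ℕ.+ i) i k (ℕP.n≤1+n (k ℕ.+ i)))

  f : PowerSeries p
  f i = record
    { res    = coefficient i
    ; compat = λ k → ∣⇒∣ᵤ (un≋ (coefficient-compatible i k)) }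

  -- f(p^{n_j}) = n_j: modulo p^k the truncated sum equals the value of
  -- G_{2k}/D_{2k} at p^{n_j}, which is n_j.
  f-at-node : ∀ j → EvalAtPowEq p f (node j) (node j)
  f-at-node j k = ∣⇒∣ᵤ (un≋ (begin
    sumℤ (λ i → coefficient i k * w i) k    ≈⟨ sumℤ-cong _ _ k term-stable ⟩
    sumℤ (λ i → d * (c i * w i)) k          ≡⟨ sumℤ-*ˡ d (λ i → c i * w i) k ⟩
    d * sumℤ (λ i → c i * w i) k            ≈⟨ ≋-*ˡ d (truncation-≋ G (P m) w w0 w-suc k p^k∣w) ⟩
    d * eval G (P m)                        ≡⟨ ℤP.*-comm d (eval G (P m)) ⟩
    normalisedValue m k (k ℕ.+ k)           ≈⟨ value-at-node j k (k ℕ.+ k) (ℕP.m≤n⇒m≤1+n (ℕP.m≤m+n k k)) ⟩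
    + m                                     ∎))
    where
    open ≋-Reasoning (P k)
    m : ℕ
    m = node j
    G : List ℤ
    G = numer (stage (k ℕ.+ k))
    d : ℤ
    d = denom⁻¹ (stage (k ℕ.+ k)) k
    c w : ℕ → ℤ
    c i = coeff G i
    w i = + (p ℕ.^ (m ℕ.* i))
    w0 : w 0 ≡ 1ℤ
    w0 = cong (λ e → + (p ℕ.^ e)) (ℕP.*-zeroʳ m)
    w-suc : ∀ i → w (suc i) ≡ w i * P m
    w-suc i = trans (cong P (ℕP.*-suc m i)) (trans (P-+ m (m ℕ.* i)) (ℤP.*-comm (P m) (w i)))
    p^k∣w : P k ∣ w k
    p^k∣w = P-∣ (ℕP.m≤n*m k m {{ℕ.>-nonZero (node-positive j)}})
    lemma : ∀ c d w → c * d * w ≡ d * (c * w)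
    lemma = solve-∀
    term-stable : ∀ i → i < k → coefficient i k * w i ≋ d * (c i * w i) [ P k ]
    term-stable i i<k =
      ≋-trans (≋-*ʳ (w i) (≋-sym (normalisedCoeff-stable i k (ℕP.+-monoʳ-≤ k (ℕP.<⇒≤ i<k)))))
        (≋-reflexive (lemma (c i) d (w i)))

  nodeSum-stage : ∀ j → nodeSum (stage j) ≡ sumℕ node (suc j)
  nodeSum-stage zero    = ℕP.+-identityʳ n₁
  nodeSum-stage (suc j) =
    trans (cong (node (suc j) ℕ.+_) (nodeSum-stage j)) (ℕP.+-comm (node (suc j)) (sumℕ node (suc j)))

  node-upper : ∀ j → node (suc j) ≤ node j ℕ.+ p ℕ.^ sumℕ node (suc j)
  node-upper j = subst (λ e → node (suc j) ≤ node j ℕ.+ p ℕ.^ e) (nodeSum-stage j) (ValidStage.nextNode-upper (valid j))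

  earlier-sum≤node : ∀ j → sumℕ node j ≤ node j
  earlier-sum≤node zero    = z≤n
  earlier-sum≤node (suc j) = subst (_≤ node (suc j)) (nodeSum-stage j) (ValidStage.nodeSum≤nextNode (valid j))

  node-upper-doubled : ∀ j → node (suc j) ≤ node j ℕ.+ p ℕ.^ (2 ℕ.* node j)
  node-upper-doubled j = ℕP.≤-trans (node-upper j) (ℕP.+-monoʳ-≤ (node j) (ℕP.^-monoʳ-≤ p sum≤2n))
    where
    sum≤2n : sumℕ node (suc j) ≤ 2 ℕ.* node j
    sum≤2n = subst (sumℕ node (suc j) ≤_) (cong (node j ℕ.+_) (sym (ℕP.+-identityʳ (node j))))
               (ℕP.+-monoˡ-≤ (node j) (earlier-sum≤node j))

open import Data.Nat using (suc; _+_; _*_; _^_)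
open import Data.Nat.Base using (nonTrivial⇒n>1)
open import Data.Nat.Primality using (Prime; prime⇒nonTrivial)
open import Data.Product using (Σ; _×_; _,_)
open import Relation.Binary.PropositionalEquality using (_≡_; refl)

proposition7p1 : ∀ (p : ℕ) → Prime p → ∀ (n₁ : ℕ) → 1 ≤ n₁ →
    Σ (ℕ → ℕ) λ n → Σ (PowerSeries p) λ f →
      (n 0 ≡ n₁)
      × (∀ j → 1 ≤ n j)
      × (∀ j → n j < n (suc j))
      × (∀ j → EvalAtPowEq p f (n j) (n j))
      × (∀ j → n j + p ^ n j ≤ n (suc j))
      × (∀ j → n (suc j) ≤ n j + p ^ sumℕ n (suc j))
      × (∀ j → sumℕ n (suc j) ≤ n (suc j))
      × (∀ j → n (suc j) ≤ n j + p ^ (2 * n j))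
proposition7p1 p p-prime n₁ 1≤n₁ =
  node , f , refl , node-positive , (λ j → newest<nextNode (stage j)) , f-at-node ,
  (λ j → nextNode-lower (stage j)) , node-upper , (λ j → earlier-sum≤node (suc j)) , node-upper-doubled
  where open Construction p (nonTrivial⇒n>1 p {{prime⇒nonTrivial p-prime}}) n₁ 1≤n₁
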